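{- Work in the "linear" axiomatic framework for three-dimensional projective space described in the context. Let $o,p,q,r$ be a plane-tetrad, and let its diagonals be the lines $$a \in \mathrm{pt}(o,p)\cap\mathrm{pt}(q,r),\quad b \in \mathrm{pt}(o,q)\cap\mathrm{pt}(r,p),\quad c \in \mathrm{pt}(o,r)\cap\mathrm{pt}(p,q)$$ (each of these intersections consists of exactly one line). Then $a, b, c$ are pairwise distinct and each of $a,b,c$ is distinct from each of $o,p,q,r$.
   Context: Let $\mathbb{L}$ be a set (whose elements are called lines) with a symmetric reflexive relation $\sim$ (incidence). Lines that are not incident are called skew. For $S \subseteq \mathbb{L}$ let $S^{\sim}$ be the set of all lines incident to every line of $S$, and write $[l_1 \dots l_n] = \{l_1,\dots,l_n\}^{\sim}$. The axioms are: Axiom [1]: for each line $l$, the set $\{l\}^{\sim}$ contains three pairwise skew lines. Axiom [2]: for each incident pair of distinct lines $a,b$: (2.1) $[ab]$ contains skew pairs of lines; (2.2) if $c \in [ab]\setminus[ab]^{\sim}$ is one of such a skew pair, then no skew pairs lie in $[abc]$; (2.3) if $x,y$ is a skew pair in $[ab]$ then $[ab] = [abx]\cup[aby]$. Axiom [3]: if $a,b$ is an incident line pair and $c \in [ab]\setminus[ab]^{\sim}$, then there exist an incident line pair $p,q$ and $r \in [pq]\setminus[pq]^{\sim}$ with $[abc]\cap[pqr]=\emptyset$. For incident distinct lines $a,b$ put $\Sigma(a,b) = [ab]\setminus[ab]^{\sim}$; incidence restricted to $\Sigma(a,b)$ is an equivalence relation with exactly two classes, which (as part of the structure) are labelled $\Sigma_{\mathrm{pt}}(a,b)$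 and $\Sigma_{\mathrm{pl}}(a,b)$. The point $\mathrm{pt}(a,b) = [abc]$ with $c \in \Sigma_{\mathrm{pt}}(a,b)$ and the plane $\mathrm{pl}(a,b) = [abc]$ with $c \in \Sigma_{\mathrm{pl}}(a,b)$ are independent of the choice of $c$. Axiom [4]: whenever $a,b$ and $p,q$ are pairs of distinct incident lines, $\mathrm{pt}(a,b)\cap\mathrm{pt}(p,q)\neq\emptyset$ and $\mathrm{pl}(a,b)\cap\mathrm{pl}(p,q)\neq\emptyset$. A triad is a triple of pairwise-incident lines $a,b,c$ with $c \in \Sigma(a,b)$ (equivalently $a\in\Sigma(b,c)$, equivalently $b \in \Sigma(c,a)$). It is a plane-triad if $a\in\Sigma_{\mathrm{pl}}(b,c)$, $b\in\Sigma_{\mathrm{pl}}(c,a)$, $c\in\Sigma_{\mathrm{pl}}(a,b)$, and a point-triad if the same holds with $\mathrm{pt}$ in place of $\mathrm{pl}$. A plane-tetrad is a set $\{o,p,q,r\}$ of four pairwise-incident lines such that each of the triples $\{p,q,r\},\{o,q,r\},\{o,r,p\},\{o,p,q\}$ is a plane-triad. -}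

module Defs where

open import Data.Product using (Σ; ∃; ∃-syntax; _×_; _,_)
open import Data.Sum using (_⊎_)
open import Data.Empty using (⊥)
open import Relation.Nullary using (¬_)
open import Relation.Binary.PropositionalEquality using (_≡_)

record LineSpace : Set₁ where
  infix 4 _∼_
  field
    Line : Set
    _∼_  : Line → Line → Set
    ∼-refl : ∀ l → l ∼ l
    ∼-sym  : ∀ {l m} → l ∼ m → m ∼ l

  Skew : Line → Line → Set
  Skew x y = ¬ (x ∼ y)

  _^∼ : (Line → Set) → Line → Set
  (S ^∼) y = ∀ x → S x → x ∼ y

  [_] : Line → Line → Set
  [ a ] x = a ∼ x
  [_∣_] : Line → Line → Line → Set
  [ a ∣ b ] x = a ∼ x × b ∼ x
  [_∣_∣_] : Line → Line → Line → Line → Set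
  [ a ∣ b ∣ c ] x = a ∼ x × b ∼ x × c ∼ x

  IncPair : Line → Line → Set
  IncPair a b = ¬ (a ≡ b) × a ∼ b

  Sig : Line → Line → Line → Set
  Sig a b c = [ a ∣ b ] c × ¬ (([ a ∣ b ] ^∼) c)

  field
    ax1 : ∀ l → ∃[ x ] ∃[ y ] ∃[ z ]
            ([ l ] x × [ l ] y × [ l ] z × Skew x y × Skew y z × Skew x z)
    ax2-1 : ∀ a b → IncPair a b → ∃[ x ] ∃[ y ] ([ a ∣ b ] x × [ a ∣ b ] y × Skew x y)
    ax2-2 : ∀ a b → IncPair a b → ∀ c → Sig a b c →
            (∃[ d ] ([ a ∣ b ] d × Skew c d)) →
            ∀ x y → [ a ∣ b ∣ c ] x → [ a ∣ b ∣ c ] y → x ∼ y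
    ax2-3 : ∀ a b → IncPair a b → ∀ x y → [ a ∣ b ] x → [ a ∣ b ] y → Skew x y →
            ∀ z → [ a ∣ b ] z → [ a ∣ b ∣ x ] z ⊎ [ a ∣ b ∣ y ] z
    ax3 : ∀ a b → IncPair a b → ∀ c → Sig a b c →
          ∃[ p ] ∃[ q ] ∃[ r ] (IncPair p q × Sig p q r ×
            (∀ x → [ a ∣ b ∣ c ] x → [ p ∣ q ∣ r ] x → ⊥))
    Sig-pt : Line → Line → Line → Set
    Sig-pl : Line → Line → Line → Set
    pt-sub  : ∀ a b → IncPair a b → ∀ c → Sig-pt a b c → Sig a b c
    pl-sub  : ∀ a b → IncPair a b → ∀ c → Sig-pl a b c → Sig a b c
    cover   : ∀ a b → IncPair a b → ∀ c → Sig a b c → Sig-pt a b c ⊎ Sig-pl a b c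
    pt-ne   : ∀ a b → IncPair a b → ∃[ c ] Sig-pt a b c
    pl-ne   : ∀ a b → IncPair a b → ∃[ c ] Sig-pl a b c
    pt-pt   : ∀ a b → IncPair a b → ∀ c d → Sig-pt a b c → Sig-pt a b d → c ∼ d
    pl-pl   : ∀ a b → IncPair a b → ∀ c d → Sig-pl a b c → Sig-pl a b d → c ∼ d
    pt-pl   : ∀ a b → IncPair a b → ∀ c d → Sig-pt a b c → Sig-pl a b d → Skew c d

  pt : Line → Line → Line → Set
  pt a b x = ∃[ c ] (Sig-pt a b c × [ a ∣ b ∣ c ] x)
  pl : Line → Line → Line → Set
  pl a b x = ∃[ c ] (Sig-pl a b c × [ a ∣ b ∣ c ] x)

  field
    ax4-pt : ∀ a b p q → IncPair a b → IncPair p q → ∃[ x ] (pt a b x × pt p q x)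
    ax4-pl : ∀ a b p q → IncPair a b → IncPair p q → ∃[ x ] (pl a b x × pl p q x)

  Triad : Line → Line → Line → Set
  Triad a b c = IncPair a b × b ∼ c × c ∼ a × Sig a b c

  PlaneTriad : Line → Line → Line → Set
  PlaneTriad a b c = Triad a b c × Sig-pl b c a × Sig-pl c a b × Sig-pl a b c

  PlaneTetrad : Line → Line → Line → Line → Set
  PlaneTetrad o p q r =
    (¬ o ≡ p × ¬ o ≡ q × ¬ o ≡ r × ¬ p ≡ q × ¬ p ≡ r × ¬ q ≡ r) ×
    (o ∼ p × o ∼ q × o ∼ r × p ∼ q × p ∼ r × q ∼ r) ×
    PlaneTriad p q r × PlaneTriad o q r × PlaneTriad o r p × PlaneTriad o p q

-- In the intended model pt(u,v) is the star of lines through the point u ∩ v and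
-- Σ_pl(u,v) consists of lines in the plane spanned by u, v but not through u ∩ v;
-- in a plane-tetrad the two other lines lie in Σ_pl of every edge.  Since the
-- classes Σ_pt and Σ_pl are mutually skew, no line of pt(u,v) lies in Σ_pl(u,v),
-- which separates each diagonal from the four lines of the tetrad.  If two
-- diagonals coincided, the common line x would lie in pt(o,v) and pt(o,w) for
-- distinct v, w; then x, o and the third line span a pencil [o x w] containing a
-- Σ_pt(o,w)-line and v, which are skew — so x must be o itself, already excluded.
module Submission where

open import Defs
open import Data.Product using (_×_; _,_; proj₁; proj₂)
open import Data.Sum using (inj₁; inj₂)
open import Data.Empty using (⊥-elim)
open import Relation.Nullary using (¬_)
open import Relation.Binary.PropositionalEquality using (_≡_; refl; sym)

module PlaneClasses (S : LineSpace) where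
  open LineSpace S

  Sig-swap : ∀ {u v t} → Sig u v t → Sig v u t
  Sig-swap ((u∼t , v∼t) , ¬central) =
    (v∼t , u∼t) , λ central → ¬central (λ x x∈ → central x (proj₂ x∈ , proj₁ x∈))

  IncPair-swap : ∀ {u v} → IncPair u v → IncPair v u
  IncPair-swap (u≢v , u∼v) = (λ v≡u → u≢v (sym v≡u)) , ∼-sym u∼v

  pt-∉-Sig-pl : ∀ {u v x} → IncPair u v → pt u v x → ¬ Sig-pl u v x
  pt-∉-Sig-pl I (c , c∈pt , _ , _ , c∼x) x∈pl = pt-pl _ _ I c _ c∈pt x∈pl c∼x

  pt-≢-Sig-pl : ∀ {u v x t} → IncPair u v → pt u v x → Sig-pl u v t → ¬ x ≡ t
  pt-≢-Sig-pl I x∈pt t∈pl refl = pt-∉-Sig-pl I x∈pt t∈pl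

  Sig-pl-closed : ∀ {u v t y} → IncPair u v → Sig u v t → Sig-pl u v y → t ∼ y →
                  Sig-pl u v t
  Sig-pl-closed {u} {v} {t} {y} I t∈Σ y∈pl t∼y with cover u v I t t∈Σ
  ... | inj₁ t∈pt = ⊥-elim (pt-pl u v I t y t∈pt y∈pl t∼y)
  ... | inj₂ t∈pl = t∈pl

  -- The axioms do not relate the labelling of Σ(v,u) to that of Σ(u,v); an
  -- incident Σ_pl(u,v)-line is what fixes the class.
  Sig-pl-swap : ∀ {u v t y} → IncPair u v → Sig-pl v u t → Sig-pl u v y → t ∼ y →
                Sig-pl u v t
  Sig-pl-swap {u} {v} {t} I t∈pl =
    Sig-pl-closed I (Sig-swap (pl-sub v u (IncPair-swap I) t t∈pl))

  common-pt-line-¬¬≡ : ∀ {u v w x} → IncPair u v → IncPair u w →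
                       Sig-pl u v w → Sig-pl u w v → pt u v x → pt u w x → ¬ ¬ x ≡ u
  common-pt-line-¬¬≡ {u} {v} {w} {x} Iuv Iuw w∈pl v∈pl
    (cv , cv∈pt , u∼x , v∼x , cv∼x) (cw , cw∈pt , _ , w∼x , cw∼x) x≢u =
    pt-pl u w Iuw cw v cw∈pt v∈pl
      (ax2-2 u x Iux w w∈Σux (cv , cv∈[ux] , λ w∼cv → cv≁w (∼-sym w∼cv))
             cw v cw∈[uxw] v∈[uxw])
    where
    cv≁w : Skew cv w
    cv≁w = pt-pl u v Iuv cv w cv∈pt w∈pl
    Iux : IncPair u x
    Iux = (λ u≡x → x≢u (sym u≡x)) , u∼x
    cv∈[ux] : [ u ∣ x ] cv
    cv∈[ux] = proj₁ (proj₁ (pt-sub u v Iuv cv cv∈pt)) , ∼-sym cv∼x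
    w∈Σux : Sig u x w
    w∈Σux = (proj₁ (proj₁ (pl-sub u v Iuv w w∈pl)) , ∼-sym w∼x) ,
            λ central → cv≁w (central cv cv∈[ux])
    cw∈[uxw] : [ u ∣ x ∣ w ] cw
    cw∈[uxw] with pt-sub u w Iuw cw cw∈pt
    ... | (u∼cw , w∼cw) , _ = u∼cw , ∼-sym cw∼x , w∼cw
    v∈[uxw] : [ u ∣ x ∣ w ] v
    v∈[uxw] = proj₂ Iuv , ∼-sym v∼x , ∼-sym (proj₂ (proj₁ (pl-sub u v Iuv w w∈pl)))

  PlanarEdge : Line → Line → Line → Line → Set
  PlanarEdge u v w z = IncPair u v × Sig-pl u v w × Sig-pl u v z

  pt-≢-PlanarEdge : ∀ {u v w z x} → PlanarEdge u v w z → pt u v x → ¬ x ≡ w × ¬ x ≡ z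
  pt-≢-PlanarEdge (I , w∈pl , z∈pl) x∈pt = pt-≢-Sig-pl I x∈pt w∈pl , pt-≢-Sig-pl I x∈pt z∈pl

  PlaneTetrad-edges : ∀ {o p q r} → PlaneTetrad o p q r →
    PlanarEdge o p q r × PlanarEdge o q r p × PlanarEdge o r p q ×
    PlanarEdge q r o p × PlanarEdge r p o q × PlanarEdge p q o r
  PlaneTetrad-edges {o} {p} {q} {r}
    ((o≢p , o≢q , o≢r , p≢q , p≢r , q≢r) , (o∼p , o∼q , o∼r , p∼q , p∼r , q∼r) ,
     (_ , p∈qr , q∈rp , r∈pq) , (_ , o∈qr , q∈ro , r∈oq) ,
     (_ , o∈rp , r∈po , p∈or) , (_ , o∈pq , p∈qo , q∈op)) =
      (Iop , q∈op , Sig-pl-swap Iop r∈po q∈op (∼-sym q∼r))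
    , (Ioq , r∈oq , Sig-pl-swap Ioq p∈qo r∈oq p∼r)
    , (Ior , p∈or , Sig-pl-swap Ior q∈ro p∈or (∼-sym p∼q))
    , ((q≢r , q∼r) , o∈qr , p∈qr)
    , (IncPair-swap (p≢r , p∼r) , o∈rp , q∈rp)
    , ((p≢q , p∼q) , o∈pq , r∈pq)
    where
    Iop : IncPair o p
    Iop = o≢p , o∼p
    Ioq : IncPair o q
    Ioq = o≢q , o∼q
    Ior : IncPair o r
    Ior = o≢r , o∼r

theorem2 : (S : LineSpace) → let open LineSpace S in
    ∀ o p q r a b c → PlaneTetrad o p q r →
    pt o p a → pt q r a → pt o q b → pt r p b → pt o r c → pt p q c →
    (¬ a ≡ b × ¬ b ≡ c × ¬ a ≡ c) ×
    (¬ a ≡ o × ¬ a ≡ p × ¬ a ≡ q × ¬ a ≡ r) ×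
    (¬ b ≡ o × ¬ b ≡ p × ¬ b ≡ q × ¬ b ≡ r) ×
    (¬ c ≡ o × ¬ c ≡ p × ¬ c ≡ q × ¬ c ≡ r)
theorem2 S o p q r a b c tetrad a∈op a∈qr b∈oq b∈rp c∈or c∈pq
  with PlaneClasses.PlaneTetrad-edges S tetrad
... | eop@(Iop , q∈op , r∈op) , eoq@(Ioq , r∈oq , p∈oq) , eor@(Ior , p∈or , q∈or)
    , eqr , erp , epq =
  let a≢o , a≢p = pt-≢-PlanarEdge eqr a∈qr
      a≢q , a≢r = pt-≢-PlanarEdge eop a∈op
      b≢o , b≢q = pt-≢-PlanarEdge erp b∈rp
      b≢r , b≢p = pt-≢-PlanarEdge eoq b∈oq
      c≢o , c≢r = pt-≢-PlanarEdge epq c∈pq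
      c≢p , c≢q = pt-≢-PlanarEdge eor c∈or
  in ( (λ { refl → common-pt-line-¬¬≡ Iop Ioq q∈op p∈oq a∈op b∈oq a≢o })
     , (λ { refl → common-pt-line-¬¬≡ Ioq Ior r∈oq q∈or b∈oq c∈or b≢o })
     , (λ { refl → common-pt-line-¬¬≡ Ior Iop p∈or r∈op c∈or a∈op a≢o }))
     , (a≢o , a≢p , a≢q , a≢r)
     , (b≢o , b≢p , b≢q , b≢r)
     , (c≢o , c≢p , c≢q , c≢r)
  where open PlaneClasses S
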